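{- Let $E=\{1,\ldots,m\}$, let $\mathcal F$ be a nonempty family of subsets of $E$ all of the same cardinality $s$, and let $I=\{X: X\subseteq S \text{ for some } S\in\mathcal F\}$. The following statements are equivalent: (i) $(E,I)$ is a matroid, i.e., for all $S_1,S_2\in\mathcal F$ and every $i\in S_1\setminus S_2$ there exists $j\in S_2\setminus S_1$ with $(S_1\setminus\{i\})\cup\{j\}\in\mathcal F$. (ii) For every real $m\times m$ matrix $W=(w(i,j))$ and every permutation $\pi$ of $\{1,\ldots,m\}$ such that $\pi(W)$ is row graded: if the $\pi$-critical base $S^0$ is a minimum weight base with respect to the weights $f^i:=\sum_{j\in S^0}w(i,j)$, $i\in E$ (i.e., $S^0$ minimizes $\sum_{j\in S}f^j$ over $S\in\mathcal F$), then $S^0$ is an optimal solution of the QMWB with cost matrix $W$. (iii) For every real $m\times m$ matrix $W$ and every permutation $\pi$ such that $\pi(W)$ is doubly graded, the $\pi$-critical base $S^0$ is an optimal solution of the QMWB with cost matrix $W$, and moreover the natural lower bound $\bar L$ equals the optimal objective function value of this QMWB.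
   Context: QMWB with cost matrix $W$: minimize $\Pi(S)=\sum_{i\in S}\sum_{j\in S}w(i,j)$ over $S\in\mathcal F$. For each $i\in E$, let $f^i$ (in (iii)) denote the optimal value of $\min_{S\in\mathcal F}\sum_{j\in S}w(i,j)$; the natural lower bound $\bar L$ is the optimal value of $\min_{S\in\mathcal F}\sum_{j\in S}f^j$. An $m\times m$ matrix $W$ is row graded if $w(i,1)\leq\cdots\leq w(i,m)$ for all $i$, and doubly graded if both $W$ and $W^T$ are row graded. For a permutation $\pi$, $\pi(W)$ is the matrix with $(i,j)$-entry $w(\pi^{ -1}(i),\pi^{ -1}(j))$. The $\pi$-critical base is the base $\{i_1,\ldots,i_s\}\in\mathcal F$ for which $\{\pi(i_1),\ldots,\pi(i_s)\}$ is lexicographically smallest (comparing sets as increasingly sorted sequences) among all $\{\pi(j_1),\ldots,\pi(j_s)\}$ with $\{j_1,\ldots,j_s\}\in\mathcal F$.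
   Formalization: The cost matrices W in conditions (ii) and (iii) have rational entries instead of real ones. -}

module Defs where

open import Data.Bool using (Bool; true; false)
open import Data.Nat using (ℕ; zero; suc)
open import Data.Fin using (Fin; zero; suc) renaming (_≤_ to _≤ᶠ_; _<_ to _<ᶠ_)
open import Data.Fin.Subset using (Subset; _∈_; _∉_; _-_; _∪_; ⁅_⁆)
open import Data.Fin.Permutation using (Permutation′; _⟨$⟩ˡ_)
open import Data.Vec using (Vec; []; _∷_; tabulate; lookup)
open import Data.List using (List; []; _∷_; map)
import Data.List.Membership.Propositional as LM
open import Data.List.Relation.Binary.Lex.Core using (Lex-≤)
open import Data.Rational using (ℚ; 0ℚ; _+_; _≤_; _⊓_)
open import Data.Product using (Σ; _×_; ∃-syntax)
open import Relation.Binary.PropositionalEquality using (_≡_)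

-- A (real, here rational) m×m cost matrix, indexed by E = Fin m.
Matrix : ℕ → Set
Matrix m = Fin m → Fin m → ℚ

Family : ℕ → Set
Family m = List (Subset m)

_∈F_ : ∀ {m} → Subset m → Family m → Set
S ∈F F = S LM.∈ F

sumSub : ∀ {m} → Subset m → (Fin m → ℚ) → ℚ
sumSub [] f = 0ℚ
sumSub (true ∷ S) f = f zero + sumSub S (λ j → f (suc j))
sumSub (false ∷ S) f = sumSub S (λ j → f (suc j))

Π : ∀ {m} → Matrix m → Subset m → ℚ
Π W S = sumSub S (λ i → sumSub S (λ j → W i j))

-- minimum of g over a list (value 0 on the empty list; only used for nonempty F)
minOver : ∀ {m} → Family m → (Subset m → ℚ) → ℚ
minOver [] g = 0ℚ
minOver (S ∷ []) g = g S
minOver (S ∷ T ∷ F) g = g S ⊓ minOver (T ∷ F) g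

Exchange : ∀ {m} → Family m → Set
Exchange F = ∀ S₁ S₂ → S₁ ∈F F → S₂ ∈F F → ∀ i → i ∈ S₁ → i ∉ S₂ →
  ∃[ j ] (j ∈ S₂ × j ∉ S₁ × ((S₁ - i) ∪ ⁅ j ⁆) ∈F F)

permMat : ∀ {m} → Permutation′ m → Matrix m → Matrix m
permMat π W i j = W (π ⟨$⟩ˡ i) (π ⟨$⟩ˡ j)

transpose : ∀ {m} → Matrix m → Matrix m
transpose W i j = W j i

RowGraded : ∀ {m} → Matrix m → Set
RowGraded W = ∀ i j k → j ≤ᶠ k → W i j ≤ W i k

DoublyGraded : ∀ {m} → Matrix m → Set
DoublyGraded W = RowGraded W × RowGraded (transpose W)

imageSub : ∀ {m} → Permutation′ m → Subset m → Subset m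
imageSub π S = tabulate (λ j → lookup S (π ⟨$⟩ˡ j))

elems : ∀ {m} → Subset m → List (Fin m)
elems [] = []
elems (true ∷ S) = zero ∷ map suc (elems S)
elems (false ∷ S) = map suc (elems S)

_≤lex_ : ∀ {m} → Subset m → Subset m → Set
A ≤lex B = Lex-≤ _≡_ _<ᶠ_ (elems A) (elems B)

IsCritical : ∀ {m} → Family m → Permutation′ m → Subset m → Set
IsCritical F π S = S ∈F F × (∀ T → T ∈F F → imageSub π S ≤lex imageSub π T)

QMWBOptimal : ∀ {m} → Family m → Matrix m → Subset m → Set
QMWBOptimal F W S = S ∈F F × (∀ T → T ∈F F → Π W S ≤ Π W T)

MinWeightBase : ∀ {m} → Family m → (Fin m → ℚ) → Subset m → Set
MinWeightBase F f S = S ∈F F × (∀ T → T ∈F F → sumSub S f ≤ sumSub T f)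

fLB : ∀ {m} → Family m → Matrix m → Fin m → ℚ
fLB F W i = minOver F (λ S → sumSub S (λ j → W i j))

lowerBound : ∀ {m} → Family m → Matrix m → ℚ
lowerBound F W = minOver F (λ S → sumSub S (fLB F W))

Cond2 : ∀ {m} → Family m → Set
Cond2 {m} F = ∀ (W : Matrix m) (π : Permutation′ m) → RowGraded (permMat π W) →
  ∀ S⁰ → IsCritical F π S⁰ →
  MinWeightBase F (λ i → sumSub S⁰ (λ j → W i j)) S⁰ →
  QMWBOptimal F W S⁰

Cond3 : ∀ {m} → Family m → Set
Cond3 {m} F = ∀ (W : Matrix m) (π : Permutation′ m) → DoublyGraded (permMat π W) →
  ∀ S⁰ → IsCritical F π S⁰ →
  QMWBOptimal F W S⁰ × lowerBound F W ≡ minOver F (Π W)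

module Submission where

-- In a matroid the π-critical base S⁰ is a minimum weight base for every weight
-- vector c for which π(c) is graded. Induct on |T ─ S⁰|: let p be the first position at which π(S⁰)
-- and π(T) differ. If p ∈ π(T) ∖ π(S⁰), lexicographic minimality puts all of π(S⁰) before p, yet the
-- exchange axiom yields an element of S⁰ ∖ T, which lies after p. So p = π a with a ∈ S⁰ ∖ T, and the
-- dual exchange axiom replaces some j ∈ T ∖ S⁰, lying after p, by a, which does not increase the
-- weight. Applied to every row of W this gives Π(S⁰) ≤ Σ_{i∈T} Σ_{j∈S⁰} w(i,j) ≤ Π(T) under the
-- hypothesis of (ii). In (iii) the columns are graded too, so f itself is graded and S⁰ is a minimum
-- weight base for f; moreover S⁰ attains every f^i, whence L̄ = Π(S⁰).
--
-- Given S₁, S₂ and i ∈ S₁ ∖ S₂ for which no exchange is possible, order E so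
-- that A = S₁ - i comes first, then S₂, then the rest, and give cost 1 exactly to the elements
-- outside A ∪ S₂. Being lexicographically minimal, the critical base contains the initial segment A
-- of the order, which lies in the base S₁; so it is A ∪ ⁅ x ⁆, and x ∉ S₂ because the exchange fails.
-- For the graded matrices w(i,j) = c j (for which every base is a minimum weight base) and
-- w(i,j) = c i + c j, the critical base then costs at least 1 while Π(S₂) = 0.

open import Defs
open import Data.Nat using (ℕ)
open import Data.Fin.Subset using (∣_∣)
open import Data.List using ([])
open import Data.List.Relation.Unary.All using (All)
open import Data.Product using (_×_; _,_)
open import Function.Bundles using (_⇔_; mk⇔)
open import Relation.Binary.PropositionalEquality using (_≡_; _≢_)

open import Algebra.Bundles using (CommutativeMonoid)
import Data.Bool.Properties as Boolₚ
open import Data.Fin.Base as Fin using (Fin; zero; suc; fromℕ<; combine; punchOut)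
open import Data.Fin.Patterns using (0F; 1F; 2F)
import Data.Fin.Properties as Finₚ
open import Data.Fin.Permutation using (Permutation′; _⟨$⟩ʳ_; _⟨$⟩ˡ_; inverseˡ; inverseʳ; permutation)
open import Data.Fin.Subset using (Subset; inside; outside; _∈_; _∉_; _⊆_; _⊂_; _─_; _-_; _∪_; ⁅_⁆; Empty)
open import Data.Fin.Subset.Properties
import Data.List.Extrema
open import Data.List.Base using (List; _∷_; map)
import Data.List.Membership.DecPropositional as DecMembership
open import Data.List.Membership.Propositional using () renaming (_∈_ to _∈ₗ_)
open import Data.List.Membership.Propositional.Properties using (∈-map⁺)
open import Data.List.Relation.Binary.Lex.Core using (Lex-≤; base; halt; this; next)
open import Data.List.Relation.Binary.Lex.Strict using () renaming (≤-decTotalOrder to lex-decTotalOrder)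
import Data.List.Relation.Unary.All as All
import Data.List.Relation.Unary.Any as Any
import Data.Nat.Base as ℕ
open import Data.Nat.Induction using (<-wellFounded)
import Data.Nat.Properties as ℕₚ
open import Data.Product using (proj₁; proj₂; ∃-syntax)
open import Data.Rational using (ℚ; 0ℚ; 1ℚ; _+_; _≤_; _<_; _⊓_; +-0-rawMonoid)
open import Data.Rational.Properties
  using ( ≤-refl; ≤-reflexive; ≤-trans; ≤-antisym; <-irrefl; +-mono-≤; +-monoˡ-≤; +-monoʳ-≤; +-mono-<-≤
        ; +-identityˡ; +-identityʳ; p⊓q≤p; p⊓q≤q; ⊓-glb; nonNegative⁻¹; positive⁻¹; +-0-commutativeMonoid
        ; module ≤-Reasoning)
open import Data.Sum using (_⊎_; inj₁; inj₂)
open import Data.Vec.Base using ([]; _∷_; here; there; lookup; tabulate)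
open import Data.Vec.Properties using (lookup∘tabulate; []=⇒lookup; lookup⇒[]=; ≡-dec)
open import Function.Base using (_∘_)
open import Function.Definitions using (Injective)
open import Induction.WellFounded using (Acc; acc)
open import Level using (0ℓ)
open import Relation.Binary.Bundles using (DecTotalOrder)
open import Relation.Binary.Core using (_Preserves_⟶_)
open import Relation.Binary.Definitions using (tri<; tri≈; tri>)
open import Relation.Binary.PropositionalEquality
  using (refl; sym; trans; cong; cong₂; subst; subst₂; module ≡-Reasoning)
open import Relation.Nullary using (¬_; Dec; yes; no; does; ¬?; contradiction)
open import Relation.Nullary.Decidable using (_×-dec_; decidable-stable; dec-true)
open import Relation.Unary using (Pred; Decidable)

open import Algebra.Definitions.RawMonoid +-0-rawMonoid using () renaming (_×_ to _·_)
open import Algebra.Properties.CommutativeSemigroup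
  (CommutativeMonoid.commutativeSemigroup +-0-commutativeMonoid) using (x∙yz≈y∙xz)

private
  variable
    m : ℕ
    k x y z : Fin m
    p q S T U V D : Subset m
    g : Fin m → ℚ

⊈-witness : ¬ (p ⊆ q) → ∃[ x ] (x ∈ p × x ∉ q)
⊈-witness {p = p} {q} p⊈q = decidable-stable (Finₚ.any? λ x → x ∈? p ×-dec ¬? (x ∈? q))
  λ none → p⊈q λ {x} x∈p → decidable-stable (x ∈? q) λ x∉q → none (x , x∈p , x∉q)

p⊆q∧∣q∣≤∣p∣⇒p≡q : p ⊆ q → ∣ q ∣ ℕ.≤ ∣ p ∣ → p ≡ q
p⊆q∧∣q∣≤∣p∣⇒p≡q {p = p} {q} p⊆q ∣q∣≤∣p∣ with q ⊆? p
... | yes q⊆p = ⊆-antisym p⊆q q⊆p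
... | no q⊈p with ⊈-witness q⊈p
...   | x , x∈q , x∉p = contradiction ∣q∣≤∣p∣ (ℕₚ.<⇒≱ (p⊂q⇒∣p∣<∣q∣ (p⊆q , x , x∈q , x∉p)))

x∈p─q⇒x∉q : x ∈ p ─ q → x ∉ q
x∈p─q⇒x∉q {p = _ ∷ p} {inside  ∷ q} ()        here
x∈p─q⇒x∉q {p = _ ∷ p} {outside ∷ q} here      ()
x∈p─q⇒x∉q {p = _ ∷ p} {_       ∷ q} (there x∈) (there x∈q) = x∈p─q⇒x∉q x∈ x∈q

x∈p-y⇒x≢y : x ∈ p - y → x ≢ y
x∈p-y⇒x≢y {y = y} x∈ refl = x∈p─q⇒x∉q x∈ (x∈⁅x⁆ y)

x∈p⇒suc∣p-x∣≡∣p∣ : x ∈ p → ℕ.suc ∣ p - x ∣ ≡ ∣ p ∣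
x∈p⇒suc∣p-x∣≡∣p∣ {p = inside  ∷ p} here        = cong (ℕ.suc ∘ ∣_∣) (p─⊥≡p p)
x∈p⇒suc∣p-x∣≡∣p∣ {p = inside  ∷ p} (there x∈p) = cong ℕ.suc (x∈p⇒suc∣p-x∣≡∣p∣ x∈p)
x∈p⇒suc∣p-x∣≡∣p∣ {p = outside ∷ p} (there x∈p) = x∈p⇒suc∣p-x∣≡∣p∣ x∈p

x∉p⇒∣p∪⁅x⁆∣≡suc∣p∣ : x ∉ p → ∣ p ∪ ⁅ x ⁆ ∣ ≡ ℕ.suc ∣ p ∣
x∉p⇒∣p∪⁅x⁆∣≡suc∣p∣ {x = zero}  {inside  ∷ p} x∉p = contradiction here x∉p
x∉p⇒∣p∪⁅x⁆∣≡suc∣p∣ {x = zero}  {outside ∷ p} _   = cong (ℕ.suc ∘ ∣_∣) (∪-identityʳ p)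
x∉p⇒∣p∪⁅x⁆∣≡suc∣p∣ {x = suc x} {inside  ∷ p} x∉p = cong ℕ.suc (x∉p⇒∣p∪⁅x⁆∣≡suc∣p∣ (x∉p ∘ there))
x∉p⇒∣p∪⁅x⁆∣≡suc∣p∣ {x = suc x} {outside ∷ p} x∉p = x∉p⇒∣p∪⁅x⁆∣≡suc∣p∣ (x∉p ∘ there)

∈-swap⁻ : z ∈ (p - x) ∪ ⁅ y ⁆ → z ≡ y ⊎ (z ∈ p × z ≢ x)
∈-swap⁻ {p = p} {x} {y} z∈ with x∈p∪q⁻ (p - x) ⁅ y ⁆ z∈
... | inj₁ z∈p-x = inj₂ (p─q⊆p p ⁅ x ⁆ z∈p-x , x∈p-y⇒x≢y z∈p-x)
... | inj₂ z∈⁅y⁆ = inj₁ (x∈⁅y⁆⇒x≡y y z∈⁅y⁆)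

∈-swap⁺ˡ : z ∈ p → z ≢ x → z ∈ (p - x) ∪ ⁅ y ⁆
∈-swap⁺ˡ z∈p z≢x = x∈p∪q⁺ (inj₁ (x∈p∧x≢y⇒x∈p-y z∈p z≢x))

∈-swap⁺ʳ : y ∈ (p - x) ∪ ⁅ y ⁆
∈-swap⁺ʳ {y = y} = x∈p∪q⁺ (inj₂ (x∈⁅x⁆ y))

∣swap∣≡∣p∣ : x ∈ p → y ∉ p → ∣ (p - x) ∪ ⁅ y ⁆ ∣ ≡ ∣ p ∣
∣swap∣≡∣p∣ {x = x} {p} x∈p y∉p =
  trans (x∉p⇒∣p∪⁅x⁆∣≡suc∣p∣ (y∉p ∘ p─q⊆p p ⁅ x ⁆)) (x∈p⇒suc∣p-x∣≡∣p∣ x∈p)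

swap-─-⊂ : x ∈ p → x ∉ q → y ∈ q → ((p - x) ∪ ⁅ y ⁆) ─ q ⊂ p ─ q
swap-─-⊂ {x = x} {p} {q} {y} x∈p x∉q y∈q = shrinks , x , x∈p∧x∉q⇒x∈p─q x∈p x∉q , x-removed
  where
  shrinks : ((p - x) ∪ ⁅ y ⁆) ─ q ⊆ p ─ q
  shrinks z∈ with ∈-swap⁻ (p─q⊆p _ q z∈)
  ... | inj₁ refl         = contradiction y∈q (x∈p─q⇒x∉q z∈)
  ... | inj₂ (z∈p , _)    = x∈p∧x∉q⇒x∈p─q z∈p (x∈p─q⇒x∉q z∈)
  x-removed : x ∉ ((p - x) ∪ ⁅ y ⁆) ─ q
  x-removed x∈ with ∈-swap⁻ (p─q⊆p _ q x∈)
  ... | inj₁ refl         = x∉q y∈q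
  ... | inj₂ (_ , x≢x)    = x≢x refl

satisfying : ∀ {P : Pred (Fin m) 0ℓ} → Decidable P → Subset m
satisfying P? = tabulate (does ∘ P?)

∈-satisfying⁺ : ∀ {P : Pred (Fin m) 0ℓ} (P? : Decidable P) → P x → x ∈ satisfying P?
∈-satisfying⁺ {x = x} P? Px = lookup⇒[]= x _ (trans (lookup∘tabulate (does ∘ P?) x) (dec-true (P? x) Px))

∈-satisfying⁻ : ∀ {P : Pred (Fin m) 0ℓ} (P? : Decidable P) → x ∈ satisfying P? → P x
∈-satisfying⁻ {x = x} P? x∈ with P? x | trans (sym (lookup∘tabulate (does ∘ P?) x)) ([]=⇒lookup x∈)
... | yes Px | _ = Px
... | no _   | ()

sumSub-mono : ∀ (S : Subset m) {g h : Fin m → ℚ} → (∀ x → g x ≤ h x) → sumSub S g ≤ sumSub S h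
sumSub-mono []            g≤h = ≤-refl
sumSub-mono (inside  ∷ S) g≤h = +-mono-≤ (g≤h zero) (sumSub-mono S (g≤h ∘ suc))
sumSub-mono (outside ∷ S) g≤h = sumSub-mono S (g≤h ∘ suc)

sumSub-cong : ∀ (S : Subset m) {g h : Fin m → ℚ} → (∀ x → g x ≡ h x) → sumSub S g ≡ sumSub S h
sumSub-cong []            g≗h = refl
sumSub-cong (inside  ∷ S) g≗h = cong₂ _+_ (g≗h zero) (sumSub-cong S (g≗h ∘ suc))
sumSub-cong (outside ∷ S) g≗h = sumSub-cong S (g≗h ∘ suc)

sumSub-nonneg : ∀ (S : Subset m) → (∀ x → 0ℚ ≤ g x) → 0ℚ ≤ sumSub S g
sumSub-nonneg []            g≥0 = ≤-refl
sumSub-nonneg (inside  ∷ S) g≥0 = +-mono-≤ (g≥0 zero) (sumSub-nonneg S (g≥0 ∘ suc))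
sumSub-nonneg (outside ∷ S) g≥0 = sumSub-nonneg S (g≥0 ∘ suc)

≤-sumSub : (∀ x → 0ℚ ≤ g x) → x ∈ S → g x ≤ sumSub S g
≤-sumSub {g = g} {S = inside ∷ S} g≥0 here = begin
  g zero                ≡⟨ +-identityʳ (g zero) ⟨
  g zero + 0ℚ           ≤⟨ +-monoʳ-≤ (g zero) (sumSub-nonneg S (g≥0 ∘ suc)) ⟩
  g zero + sumSub S (g ∘ suc) ∎
  where open ≤-Reasoning
≤-sumSub {g = g} {x = suc x} {inside ∷ S} g≥0 (there x∈S) = begin
  g (suc x)                   ≡⟨ +-identityˡ (g (suc x)) ⟨
  0ℚ + g (suc x)              ≤⟨ +-mono-≤ (g≥0 zero) (≤-sumSub (g≥0 ∘ suc) x∈S) ⟩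
  g zero + sumSub S (g ∘ suc) ∎
  where open ≤-Reasoning
≤-sumSub {S = outside ∷ S} g≥0 (there x∈S) = ≤-sumSub (g≥0 ∘ suc) x∈S

sumSub-vanishing : (∀ {x} → x ∈ S → g x ≡ 0ℚ) → sumSub S g ≡ 0ℚ
sumSub-vanishing {S = []}          _   = refl
sumSub-vanishing {S = inside  ∷ S} g≡0 = cong₂ _+_ (g≡0 here) (sumSub-vanishing (g≡0 ∘ there))
sumSub-vanishing {S = outside ∷ S} g≡0 = sumSub-vanishing (g≡0 ∘ there)

sumSub-const : ∀ (S : Subset m) k → sumSub S (λ _ → k) ≡ ∣ S ∣ · k
sumSub-const []            k = refl
sumSub-const (inside  ∷ S) k = cong (k +_) (sumSub-const S k)
sumSub-const (outside ∷ S) k = sumSub-const S k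

sumSub-remove : x ∈ S → sumSub S g ≡ g x + sumSub (S - x) g
sumSub-remove {S = inside ∷ S} {g} here = cong (λ R → g zero + sumSub R (g ∘ suc)) (sym (p─⊥≡p S))
sumSub-remove {x = suc x} {inside ∷ S} {g} (there x∈S) =
  trans (cong (g zero +_) (sumSub-remove x∈S)) (x∙yz≈y∙xz (g zero) (g (suc x)) _)
sumSub-remove {S = outside ∷ S} (there x∈S) = sumSub-remove x∈S

sumSub-insert : x ∉ S → sumSub (S ∪ ⁅ x ⁆) g ≡ g x + sumSub S g
sumSub-insert {x = zero}  {inside  ∷ S}     x∉S = contradiction here x∉S
sumSub-insert {x = zero}  {outside ∷ S} {g} _   = cong (λ R → g zero + sumSub R (g ∘ suc)) (∪-identityʳ S)
sumSub-insert {x = suc x} {inside  ∷ S} {g} x∉S =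
  trans (cong (g zero +_) (sumSub-insert (x∉S ∘ there))) (x∙yz≈y∙xz (g zero) (g (suc x)) _)
sumSub-insert {x = suc x} {outside ∷ S}     x∉S = sumSub-insert (x∉S ∘ there)

sumSub-swap-≤ : ∀ (g : Fin m → ℚ) → x ∈ S → y ∉ S → g y ≤ g x → sumSub ((S - x) ∪ ⁅ y ⁆) g ≤ sumSub S g
sumSub-swap-≤ {x = x} {S} {y} g x∈S y∉S gy≤gx = begin
  sumSub ((S - x) ∪ ⁅ y ⁆) g ≡⟨ sumSub-insert (y∉S ∘ p─q⊆p S ⁅ x ⁆) ⟩
  g y + sumSub (S - x) g     ≤⟨ +-monoˡ-≤ (sumSub (S - x) g) gy≤gx ⟩
  g x + sumSub (S - x) g     ≡⟨ sumSub-remove x∈S ⟨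
  sumSub S g                 ∎
  where open ≤-Reasoning

≤-Π : ∀ {W : Matrix m} → (∀ i j → 0ℚ ≤ W i j) → x ∈ S → W x x ≤ Π W S
≤-Π {x = x} {S} {W} W≥0 x∈S = begin
  W x x               ≤⟨ ≤-sumSub (W≥0 x) x∈S ⟩
  sumSub S (W x)      ≤⟨ ≤-sumSub (λ i → sumSub-nonneg S (W≥0 i)) x∈S ⟩
  Π W S               ∎
  where open ≤-Reasoning

Π-vanishing : ∀ {W : Matrix m} → (∀ {i j} → i ∈ S → j ∈ S → W i j ≡ 0ℚ) → Π W S ≡ 0ℚ
Π-vanishing W≡0 = sumSub-vanishing λ i∈S → sumSub-vanishing (W≡0 i∈S)

-- Images under a permutation and the lexicographic order

lookup-imageSub : ∀ (π : Permutation′ m) S p → lookup (imageSub π S) p ≡ lookup S (π ⟨$⟩ˡ p)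
lookup-imageSub π S = lookup∘tabulate (lookup S ∘ (π ⟨$⟩ˡ_))

π⁻¹∈⇒∈imageSub : ∀ (π : Permutation′ m) → π ⟨$⟩ˡ y ∈ S → y ∈ imageSub π S
π⁻¹∈⇒∈imageSub {y = y} {S} π y∈ = lookup⇒[]= y _ (trans (lookup-imageSub π S y) ([]=⇒lookup y∈))

∈imageSub⇒π⁻¹∈ : ∀ (π : Permutation′ m) → y ∈ imageSub π S → π ⟨$⟩ˡ y ∈ S
∈imageSub⇒π⁻¹∈ {y = y} {S} π y∈ = lookup⇒[]= _ S (trans (sym (lookup-imageSub π S y)) ([]=⇒lookup y∈))

∈⇒π∈imageSub : ∀ (π : Permutation′ m) → x ∈ S → π ⟨$⟩ʳ x ∈ imageSub π S
∈⇒π∈imageSub {S = S} π x∈S = π⁻¹∈⇒∈imageSub π (subst (_∈ S) (sym (inverseˡ π)) x∈S)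

π∈imageSub⇒∈ : ∀ (π : Permutation′ m) → π ⟨$⟩ʳ x ∈ imageSub π S → x ∈ S
π∈imageSub⇒∈ {S = S} π πx∈ = subst (_∈ S) (inverseˡ π) (∈imageSub⇒π⁻¹∈ π πx∈)

lookup-imageSub-π : ∀ (π : Permutation′ m) S x → lookup (imageSub π S) (π ⟨$⟩ʳ x) ≡ lookup S x
lookup-imageSub-π π S x = trans (lookup-imageSub π S _) (cong (lookup S) (inverseˡ π))

imageSub-⊆⁻ : ∀ (π : Permutation′ m) → imageSub π S ⊆ imageSub π T → S ⊆ T
imageSub-⊆⁻ π πS⊆πT x∈S = π∈imageSub⇒∈ π (πS⊆πT (∈⇒π∈imageSub π x∈S))

imageSub-⊆⁺ : ∀ (π : Permutation′ m) → S ⊆ T → imageSub π S ⊆ imageSub π T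
imageSub-⊆⁺ π S⊆T y∈πS = π⁻¹∈⇒∈imageSub π (S⊆T (∈imageSub⇒π⁻¹∈ π y∈πS))

imageSub-injective : ∀ (π : Permutation′ m) → imageSub π S ≡ imageSub π T → S ≡ T
imageSub-injective π πS≡πT =
  ⊆-antisym (imageSub-⊆⁻ π (⊆-reflexive πS≡πT)) (imageSub-⊆⁻ π (⊆-reflexive (sym πS≡πT)))

lookup≡outside⇒∉ : lookup S x ≡ outside → x ∉ S
lookup≡outside⇒∉ S[x]≡outside x∈S with trans (sym S[x]≡outside) ([]=⇒lookup x∈S)
... | ()

∈∧∉⇒lookup≢ : x ∈ S → x ∉ T → lookup S x ≢ lookup T x
∈∧∉⇒lookup≢ {T = T} x∈S x∉T eq = x∉T (lookup⇒[]= _ T (trans (sym eq) ([]=⇒lookup x∈S)))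

lookup≢⇒∈∉ : lookup S x ≢ lookup T x → (x ∈ S × x ∉ T) ⊎ (x ∉ S × x ∈ T)
lookup≢⇒∈∉ {S = S} {x} {T} differ with lookup S x in eqS | lookup T x in eqT
... | inside  | inside  = contradiction refl differ
... | inside  | outside = inj₁ (lookup⇒[]= x S eqS , lookup≡outside⇒∉ eqT)
... | outside | inside  = inj₂ (lookup≡outside⇒∉ eqS , lookup⇒[]= x T eqT)
... | outside | outside = contradiction refl differ

AgreeBelow : Fin m → Subset m → Subset m → Set
AgreeBelow k U V = ∀ {y} → y Fin.< k → lookup U y ≡ lookup V y

first-difference : U ≢ V → ∃[ p ] (lookup U p ≢ lookup V p × AgreeBelow p U V)
first-difference {U = []}    {[]}    U≢V = contradiction refl U≢V
first-difference {U = u ∷ U} {v ∷ V} U≢V with u Boolₚ.≟ v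
... | no u≢v = zero , u≢v , λ ()
... | yes refl with first-difference (U≢V ∘ cong (u ∷_))
...   | p , differ , agree = suc p , differ , λ { {zero} _ → refl ; {suc y} (ℕ.s≤s y<p) → agree y<p }

agreeBelow-imageSub⇒≤ : ∀ (π : Permutation′ m) → AgreeBelow k (imageSub π S) (imageSub π T) →
                        x ∈ S → x ∉ T → k Fin.≤ π ⟨$⟩ʳ x
agreeBelow-imageSub⇒≤ {S = S} {T} {x} π agree x∈S x∉T = ℕₚ.≮⇒≥ λ πx<k → ∈∧∉⇒lookup≢ x∈S x∉T
  (trans (sym (lookup-imageSub-π π S x)) (trans (agree πx<k) (lookup-imageSub-π π T x)))


_≤ₗ_ : List (Fin m) → List (Fin m) → Set
_≤ₗ_ = Lex-≤ _≡_ Fin._<_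

map-suc-≤ₗ⁻ : ∀ {xs ys : List (Fin m)} → map suc xs ≤ₗ map suc ys → xs ≤ₗ ys
map-suc-≤ₗ⁻ {xs = []}    {[]}    _                    = base _
map-suc-≤ₗ⁻ {xs = []}    {_ ∷ _} _                    = halt
map-suc-≤ₗ⁻ {xs = _ ∷ _} {_ ∷ _} (this (ℕ.s≤s x<y))   = this x<y
map-suc-≤ₗ⁻ {xs = _ ∷ _} {_ ∷ _} (next refl xs≤ys)    = next refl (map-suc-≤ₗ⁻ xs≤ys)

∷-≤lex⁻ : ∀ {b} → (b ∷ U) ≤lex (b ∷ V) → U ≤lex V
∷-≤lex⁻ {b = inside}  (this ())
∷-≤lex⁻ {b = inside}  (next refl U≤V) = map-suc-≤ₗ⁻ U≤V
∷-≤lex⁻ {b = outside} U≤V             = map-suc-≤ₗ⁻ U≤V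

∈-elems : x ∈ S → x ∈ₗ elems S
∈-elems {S = inside  ∷ S} here        = Any.here refl
∈-elems {S = inside  ∷ S} (there x∈S) = Any.there (∈-map⁺ suc (∈-elems x∈S))
∈-elems {S = outside ∷ S} (there x∈S) = ∈-map⁺ suc (∈-elems x∈S)

outside-≤lex-inside : (outside ∷ U) ≤lex (inside ∷ V) → Empty U
outside-≤lex-inside {U = U} U≤V (x , x∈U) with elems U | ∈-elems x∈U | U≤V
... | []    | () | _
... | _ ∷ _ | _  | this ()
... | _ ∷ _ | _  | next () _

≤lex-first-difference : U ≤lex V → AgreeBelow k U V →
                        k ∉ U → k ∈ V → x ∈ U → x Fin.< k
≤lex-first-difference {U = inside ∷ U} {k = zero} _ _ k∉U _ _ = contradiction here k∉U
≤lex-first-difference {U = outside ∷ U} {V = inside ∷ V} {k = zero} U≤V _ _ _ (there x∈U) =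
  contradiction (_ , x∈U) (outside-≤lex-inside {U = U} {V} U≤V)
≤lex-first-difference {U = u ∷ U} {V = v ∷ V} {k = suc k} U≤V agree k∉U k∈V x∈U
  with agree {zero} (ℕ.s≤s ℕ.z≤n)
... | refl with x∈U
...   | here        = ℕ.s≤s ℕ.z≤n
...   | there x∈U′  = ℕ.s≤s (≤lex-first-difference (∷-≤lex⁻ {U = U} {V} {u} U≤V) (agree ∘ ℕ.s≤s)
                                                (k∉U ∘ there) (drop-there k∈V) x∈U′)

DownClosed : Subset m → Set
DownClosed D = ∀ {x y} → x Fin.≤ y → y ∈ D → x ∈ D

≤lex-downClosed : U ≤lex V → DownClosed D → D ⊆ V → x ∈ U → x ∉ D → D ⊆ U
≤lex-downClosed {D = outside ∷ D} _ closed _ _ _ {suc d} d∈D = contradiction (closed ℕ.z≤n d∈D) λ ()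
≤lex-downClosed {V = outside ∷ V} {D = inside ∷ D} _ _ D⊆V = contradiction (D⊆V here) λ ()
≤lex-downClosed {U = outside ∷ U} {V = inside ∷ V} {D = inside ∷ D} U≤V _ _ (there x∈U) _ =
  contradiction (_ , x∈U) (outside-≤lex-inside {U = U} {V} U≤V)
≤lex-downClosed {U = inside ∷ U} {V = inside ∷ V} {D = inside ∷ D} {x = zero} _ _ _ _ x∉D =
  contradiction here x∉D
≤lex-downClosed {U = inside ∷ U} {V = inside ∷ V} {D = inside ∷ D} {x = suc x} U≤V closed D⊆V (there x∈U) x∉D =
  in⊆in (≤lex-downClosed (∷-≤lex⁻ {U = U} {V} {inside} U≤V)
                         (λ x≤y y∈D → drop-there (closed (ℕ.s≤s x≤y) (there y∈D)))
                         (drop-∷-⊆ D⊆V) x∈U (x∉D ∘ there))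

-- Minima and critical bases

Minimizer : Family m → (Subset m → ℚ) → Subset m → Set
Minimizer F g S = S ∈F F × (∀ T → T ∈F F → g S ≤ g T)

minOver-≤ : ∀ {F : Family m} {g} → S ∈F F → minOver F g ≤ g S
minOver-≤ {F = _ ∷ []}    (Any.here refl)  = ≤-refl
minOver-≤ {F = _ ∷ _ ∷ _} (Any.here refl)  = p⊓q≤p _ _
minOver-≤ {F = _ ∷ _ ∷ _} {g} (Any.there S∈F) = ≤-trans (p⊓q≤q (g _) _) (minOver-≤ {g = g} S∈F)

≤-minOver : ∀ {F : Family m} {g b} → (∀ T → T ∈F (S ∷ F) → b ≤ g T) → b ≤ minOver (S ∷ F) g
≤-minOver {F = []}    b≤g = b≤g _ (Any.here refl)
≤-minOver {F = _ ∷ _} b≤g = ⊓-glb (b≤g _ (Any.here refl)) (≤-minOver λ T → b≤g T ∘ Any.there)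

minOver-minimizer : ∀ {F : Family m} {g} → Minimizer F g S → minOver F g ≡ g S
minOver-minimizer {F = []}    (() , _)
minOver-minimizer {F = _ ∷ _} (S∈F , minimal) = ≤-antisym (minOver-≤ S∈F) (≤-minOver minimal)

minOver-cong : ∀ (F : Family m) {g h : Subset m → ℚ} → (∀ S → g S ≡ h S) → minOver F g ≡ minOver F h
minOver-cong []          g≗h = refl
minOver-cong (S ∷ [])    g≗h = g≗h S
minOver-cong (S ∷ T ∷ F) g≗h = cong₂ _⊓_ (g≗h S) (minOver-cong (T ∷ F) g≗h)

module _ {m : ℕ} where
  open Data.List.Extrema (DecTotalOrder.totalOrder (lex-decTotalOrder (Finₚ.<-strictTotalOrder m)))
    using (argmin; argmin-sel; f[argmin]≤f[⊤]; f[argmin]≤f[xs])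

  critical-exists : ∀ {F : Family m} → F ≢ [] → ∀ π → ∃[ S ] IsCritical F π S
  critical-exists {F = []}    F≢[] _ = contradiction refl F≢[]
  critical-exists {F = S ∷ F} _    π = S⁰ , S⁰∈F , least
    where
    lexKey : Subset m → List (Fin m)
    lexKey T = elems (imageSub π T)
    S⁰ : Subset m
    S⁰ = argmin lexKey S F
    S⁰∈F : S⁰ ∈F (S ∷ F)
    S⁰∈F with argmin-sel lexKey S F
    ... | inj₁ S⁰≡S = Any.here S⁰≡S
    ... | inj₂ S⁰∈F = Any.there S⁰∈F
    least : ∀ T → T ∈F (S ∷ F) → imageSub π S⁰ ≤lex imageSub π T
    least _ (Any.here refl)  = f[argmin]≤f[⊤] {f = lexKey} S F
    least _ (Any.there T∈F) = All.lookup (f[argmin]≤f[xs] {f = lexKey} S F) T∈F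

-- Sorting permutations

injective⇒preimage : ∀ {f : Fin m → Fin m} → Injective _≡_ _≡_ f → ∀ y → ∃[ x ] f x ≡ y
injective⇒preimage {ℕ.suc m} {f} f-injective y =
  decidable-stable (Finₚ.any? λ x → f x Finₚ.≟ y) λ y∉image →
  let missed : ∀ x → y ≢ f x
      missed x y≡fx = y∉image (x , sym y≡fx)
  in ℕₚ.1+n≰n (Finₚ.injective⇒≤ {f = punchOut ∘ missed}
                 λ eq → f-injective (Finₚ.punchOut-injective (missed _) (missed _) eq))

injective⇒permutation : ∀ {f : Fin m → Fin m} → Injective _≡_ _≡_ f → ∃[ π ] (∀ x → π ⟨$⟩ʳ x ≡ f x)
injective⇒permutation {f = f} f-injective =
  permutation f (proj₁ ∘ preimage) (proj₂ ∘ preimage) (f-injective ∘ proj₂ ∘ preimage ∘ f) , λ _ → refl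
  where preimage = injective⇒preimage f-injective

module Ranking {m n} (e : Fin m → Fin n) (e-injective : Injective _≡_ _≡_ e) where

  _≺?_ : ∀ z x → Dec (e z Fin.< e x)
  z ≺? x = e z Finₚ.<? e x

  below : Fin m → Subset m
  below x = satisfying (_≺? x)

  x∉below-x : ∀ x → x ∉ below x
  x∉below-x x = Finₚ.<-irrefl refl ∘ ∈-satisfying⁻ (_≺? x)

  ∣below∣<m : ∀ x → ∣ below x ∣ ℕ.< m
  ∣below∣<m x = subst (∣ below x ∣ ℕ.<_) (∣⊤∣≡n m) (p⊂q⇒∣p∣<∣q∣ (⊆⊤ , x , ∈⊤ , x∉below-x x))

  rank : Fin m → Fin m
  rank x = fromℕ< (∣below∣<m x)

  rank-mono : e x Fin.< e y → rank x Fin.< rank y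
  rank-mono {x} {y} ex<ey = subst₂ ℕ._<_ (sym (Finₚ.toℕ-fromℕ< _)) (sym (Finₚ.toℕ-fromℕ< _))
    (p⊂q⇒∣p∣<∣q∣ (below-⊆ , x , ∈-satisfying⁺ (_≺? y) ex<ey , x∉below-x x))
    where
    below-⊆ : below x ⊆ below y
    below-⊆ z∈ = ∈-satisfying⁺ (_≺? y) (Finₚ.<-trans (∈-satisfying⁻ (_≺? x) z∈) ex<ey)

  rank-injective : Injective _≡_ _≡_ rank
  rank-injective {x} {y} rx≡ry with Finₚ.<-cmp (e x) (e y)
  ... | tri< ex<ey _ _ = contradiction rx≡ry (Finₚ.<⇒≢ (rank-mono ex<ey))
  ... | tri≈ _ ex≡ey _ = e-injective ex≡ey
  ... | tri> _ _ ey<ex = contradiction (sym rx≡ry) (Finₚ.<⇒≢ (rank-mono ey<ex))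

sorting : ∀ {n} (key : Fin m → Fin n) → ∃[ π ] (key ∘ (π ⟨$⟩ˡ_)) Preserves Fin._≤_ ⟶ Fin._≤_
sorting {m} key = π , sorted
  where
  e : Fin m → Fin _
  e x = combine (key x) x
  open Ranking e (λ {x} {y} → Finₚ.combine-injectiveʳ (key x) x (key y) y)
  π = proj₁ (injective⇒permutation rank-injective)
  rank-π⁻¹ : ∀ p → rank (π ⟨$⟩ˡ p) ≡ p
  rank-π⁻¹ p = trans (sym (proj₂ (injective⇒permutation rank-injective) _)) (inverseʳ π)
  sorted : (key ∘ (π ⟨$⟩ˡ_)) Preserves Fin._≤_ ⟶ Fin._≤_
  sorted {p} {q} p≤q = ℕₚ.≮⇒≥ λ kq<kp →
    ℕₚ.<⇒≱ (subst₂ Fin._<_ (rank-π⁻¹ q) (rank-π⁻¹ p) (rank-mono (Finₚ.combine-monoˡ-< _ _ kq<kp))) p≤q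

-- Matroids

Graded : Permutation′ m → (Fin m → ℚ) → Set
Graded π c = (c ∘ (π ⟨$⟩ˡ_)) Preserves Fin._≤_ ⟶ _≤_

rowGraded⇒graded : ∀ π (W : Matrix m) → RowGraded (permMat π W) → ∀ x → Graded π (W x)
rowGraded⇒graded π W graded x {p} {q} p≤q =
  subst (λ y → W y (π ⟨$⟩ˡ p) ≤ W y (π ⟨$⟩ˡ q)) (inverseˡ π) (graded (π ⟨$⟩ʳ x) p q p≤q)

same-size : ∀ {F : Family m} {s} → All (λ S → ∣ S ∣ ≡ s) F → S ∈F F → T ∈F F → ∣ S ∣ ≡ ∣ T ∣
same-size uniform S∈F T∈F = trans (All.lookup uniform S∈F) (sym (All.lookup uniform T∈F))

module Matroid {m} {F : Family m} {s} (uniform : All (λ S → ∣ S ∣ ≡ s) F) (exchange : Exchange F) where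

  dual-exchange : S ∈F F → T ∈F F → x ∈ T → x ∉ S → ∃[ y ] (y ∈ S × y ∉ T × ((S - y) ∪ ⁅ x ⁆) ∈F F)
  dual-exchange S∈F T∈F = go S∈F T∈F (<-wellFounded _)
    where
    go : ∀ {S T x} → S ∈F F → T ∈F F → Acc ℕ._<_ ∣ T ─ S ∣ → x ∈ T → x ∉ S →
         ∃[ y ] (y ∈ S × y ∉ T × ((S - y) ∪ ⁅ x ⁆) ∈F F)
    go {S} {T} {x} S∈F T∈F (acc smaller) x∈T x∉S
      with Finₚ.any? (λ z → z ∈? T ×-dec ¬? (z ∈? S) ×-dec ¬? (z Finₚ.≟ x))
    ... | yes (z , z∈T , z∉S , z≢x) =
      let y , y∈S , y∉T , T′∈F = exchange T S T∈F S∈F z z∈T z∉S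
          j , j∈S , j∉T′ , S′∈F = go S∈F T′∈F (smaller (p⊂q⇒∣p∣<∣q∣ (swap-─-⊂ z∈T z∉S y∈S)))
                                     (∈-swap⁺ˡ x∈T (z≢x ∘ sym)) x∉S
      in j , j∈S , (λ j∈T → j∉T′ (∈-swap⁺ˡ j∈T λ j≡z → z∉S (subst (_∈ S) j≡z j∈S))) , S′∈F
    ... | no only-x with exchange T S T∈F S∈F x x∈T x∉S
    -- x is the only element of T ∖ S, so (S - y) ∪ ⁅ x ⁆ is T itself
    ...   | y , y∈S , y∉T , _ = y , y∈S , y∉T , subst (_∈F F) (p⊆q∧∣q∣≤∣p∣⇒p≡q T⊆S′ ∣S′∣≤∣T∣) T∈F
      where
      T⊆S′ : T ⊆ (S - y) ∪ ⁅ x ⁆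
      T⊆S′ {z} z∈T with z Finₚ.≟ x
      ... | yes refl = ∈-swap⁺ʳ
      ... | no z≢x   = ∈-swap⁺ˡ (decidable-stable (z ∈? S) λ z∉S → only-x (z , z∈T , z∉S , z≢x))
                                λ { refl → y∉T z∈T }
      ∣S′∣≤∣T∣ : ∣ (S - y) ∪ ⁅ x ⁆ ∣ ℕ.≤ ∣ T ∣
      ∣S′∣≤∣T∣ = ℕₚ.≤-reflexive (trans (∣swap∣≡∣p∣ y∈S x∉S) (same-size uniform S∈F T∈F))

  module _ {π : Permutation′ m} {S⁰} (critical : IsCritical F π S⁰) where

    first-difference-∈-critical : T ∈F F → AgreeBelow k (imageSub π S⁰) (imageSub π T) →
                                  k ∈ imageSub π T → ¬ k ∉ imageSub π S⁰
    first-difference-∈-critical {T} {k} T∈F agree k∈πT k∉πS⁰ =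
      let j , j∈S⁰ , j∉T , _ = exchange T S⁰ T∈F (proj₁ critical) _
                                 (∈imageSub⇒π⁻¹∈ π k∈πT) (k∉πS⁰ ∘ π⁻¹∈⇒∈imageSub π)
      in contradiction
           (≤lex-first-difference (proj₂ critical T T∈F) agree k∉πS⁰ k∈πT (∈⇒π∈imageSub π j∈S⁰))
           (ℕₚ.≤⇒≯ (agreeBelow-imageSub⇒≤ π agree j∈S⁰ j∉T))

    critical⇒minWeightBase : ∀ {c} → Graded π c → MinWeightBase F c S⁰
    critical⇒minWeightBase {c} graded = proj₁ critical , λ T T∈F → go T∈F (<-wellFounded _)
      where
      go : ∀ {T} → T ∈F F → Acc ℕ._<_ ∣ T ─ S⁰ ∣ → sumSub S⁰ c ≤ sumSub T c
      go {T} T∈F (acc smaller) with ≡-dec Boolₚ._≟_ (imageSub π S⁰) (imageSub π T)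
      ... | yes same = ≤-reflexive (cong (λ R → sumSub R c) (imageSub-injective {S = S⁰} {T} π same))
      ... | no differ with first-difference differ
      ...   | p , p-differs , agree with lookup≢⇒∈∉ p-differs
      ...     | inj₁ (p∈πS⁰ , p∉πT) =
        let a∈S⁰ = ∈imageSub⇒π⁻¹∈ π p∈πS⁰
            a∉T = p∉πT ∘ π⁻¹∈⇒∈imageSub π
            j , j∈T , j∉S⁰ , T′∈F = dual-exchange T∈F (proj₁ critical) a∈S⁰ a∉T
            ca≤cj = subst (λ y → c (π ⟨$⟩ˡ p) ≤ c y) (inverseˡ π)
                      (graded (agreeBelow-imageSub⇒≤ π (sym ∘ agree) j∈T j∉S⁰))
        in ≤-trans (go T′∈F (smaller (p⊂q⇒∣p∣<∣q∣ (swap-─-⊂ j∈T j∉S⁰ a∈S⁰))))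
                   (sumSub-swap-≤ c j∈T a∉T ca≤cj)
      ...     | inj₂ (p∉πS⁰ , p∈πT) = contradiction p∉πS⁰ (first-difference-∈-critical T∈F agree p∈πT)

  critical⇒rowsMinimal : ∀ (W : Matrix m) π {S⁰} → RowGraded (permMat π W) → IsCritical F π S⁰ →
                         ∀ i → MinWeightBase F (W i) S⁰
  critical⇒rowsMinimal W π row-graded critical i =
    critical⇒minWeightBase {π = π} critical (rowGraded⇒graded π W row-graded i)

  exchange⇒cond2 : Cond2 F
  exchange⇒cond2 W π row-graded S⁰ critical (S⁰∈F , minimal) = S⁰∈F , λ T T∈F → begin
    Π W S⁰                           ≤⟨ minimal T T∈F ⟩
    sumSub T (λ i → sumSub S⁰ (W i)) ≤⟨ sumSub-mono T (λ i → proj₂ (rows-minimal i) T T∈F) ⟩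
    Π W T                            ∎
    where
    open ≤-Reasoning
    rows-minimal = critical⇒rowsMinimal W π row-graded critical

  exchange⇒cond3 : Cond3 F
  exchange⇒cond3 W π (row-graded , column-graded) S⁰ critical = optimal , bound-tight
    where
    f : Fin m → ℚ
    f i = sumSub S⁰ (W i)
    f-minimal : MinWeightBase F f S⁰
    f-minimal = critical⇒minWeightBase {π = π} critical {f} λ p≤q →
      sumSub-mono S⁰ λ j → rowGraded⇒graded π (transpose W) column-graded j p≤q
    optimal : QMWBOptimal F W S⁰
    optimal = exchange⇒cond2 W π row-graded S⁰ critical f-minimal
    fLB≗f : ∀ i → fLB F W i ≡ f i
    fLB≗f i = minOver-minimizer (critical⇒rowsMinimal W π row-graded critical i)
    bound-tight : lowerBound F W ≡ minOver F (Π W)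
    bound-tight = begin
      lowerBound F W               ≡⟨ minOver-cong F (λ T → sumSub-cong T fLB≗f) ⟩
      minOver F (λ T → sumSub T f) ≡⟨ minOver-minimizer f-minimal ⟩
      Π W S⁰                       ≡⟨ minOver-minimizer optimal ⟨
      minOver F (Π W)              ∎
      where open ≡-Reasoning

-- Families violating the exchange property

_∈F?_ : (S : Subset m) (F : Family m) → Dec (S ∈F F)
_∈F?_ = DecMembership._∈?_ (≡-dec Boolₚ._≟_)

record Violation (F : Family m) : Set where
  constructor violation
  field
    S₁ S₂ : Subset m
    S₁∈F  : S₁ ∈F F
    S₂∈F  : S₂ ∈F F
    i     : Fin m
    i∈S₁  : i ∈ S₁
    i∉S₂  : i ∉ S₂
    stuck : ∀ j → j ∈ S₂ → j ∉ S₁ → ¬ (((S₁ - i) ∪ ⁅ j ⁆) ∈F F)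

¬violation⇒exchange : ∀ {F : Family m} → ¬ Violation F → Exchange F
¬violation⇒exchange {F = F} no-violation S₁ S₂ S₁∈F S₂∈F i i∈S₁ i∉S₂ =
  decidable-stable (Finₚ.any? λ j → j ∈? S₂ ×-dec ¬? (j ∈? S₁) ×-dec (((S₁ - i) ∪ ⁅ j ⁆) ∈F? F)) λ none →
    no-violation (violation S₁ S₂ S₁∈F S₂∈F i i∈S₁ i∉S₂
                    λ j j∈S₂ j∉S₁ S′∈F → none (j , j∈S₂ , j∉S₁ , S′∈F))

cost : Fin 3 → ℚ
cost 0F = 0ℚ
cost 1F = 0ℚ
cost 2F = 1ℚ

cost-nonneg : ∀ a → 0ℚ ≤ cost a
cost-nonneg 0F = ≤-refl
cost-nonneg 1F = ≤-refl
cost-nonneg 2F = nonNegative⁻¹ 1ℚ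

cost-mono : cost Preserves Fin._≤_ ⟶ _≤_
cost-mono {0F} {b} _ = cost-nonneg b
cost-mono {1F} {b} _ = cost-nonneg b
cost-mono {2F} {2F} _ = ≤-refl
cost-mono {2F} {1F} (ℕ.s≤s ())

module Counterexample {m} {F : Family m} {s} (uniform : All (λ S → ∣ S ∣ ≡ s) F) (F≢[] : F ≢ [])
                      (v : Violation F) where
  open Violation v

  A : Subset m
  A = S₁ - i

  key : Fin m → Fin 3
  key x with x ∈? A | x ∈? S₂
  ... | yes _ | _     = 0F
  ... | no _  | yes _ = 1F
  ... | no _  | no _  = 2F

  key-lower : key x Fin.≤ key y → y ∈ A → x ∈ A
  key-lower {x} {y} kx≤ky y∈A with x ∈? A | x ∈? S₂ | y ∈? A
  ... | yes x∈A | _     | _       = x∈A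
  ... | no _    | _     | no y∉A  = contradiction y∈A y∉A
  ... | no _    | yes _ | yes _   = contradiction kx≤ky λ ()
  ... | no _    | no _  | yes _   = contradiction kx≤ky λ ()

  c : Fin m → ℚ
  c = cost ∘ key

  c-S₂ : x ∈ S₂ → c x ≡ 0ℚ
  c-S₂ {x} x∈S₂ with x ∈? A | x ∈? S₂
  ... | yes _ | _        = refl
  ... | no _  | yes _    = refl
  ... | no _  | no x∉S₂  = contradiction x∈S₂ x∉S₂

  0<c : x ∉ A → x ∉ S₂ → 0ℚ < c x
  0<c {x} x∉A x∉S₂ with x ∈? A | x ∈? S₂
  ... | yes x∈A | _        = contradiction x∈A x∉A
  ... | no _    | yes x∈S₂ = contradiction x∈S₂ x∉S₂
  ... | no _    | no _     = positive⁻¹ 1ℚ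

  module Refutation {π : Permutation′ m} (sorted : (key ∘ (π ⟨$⟩ˡ_)) Preserves Fin._≤_ ⟶ Fin._≤_)
                    {S⁰ : Subset m} (critical : IsCritical F π S⁰) where

    c-graded : Graded π c
    c-graded = cost-mono ∘ sorted

    ∣S⁰∣≡1+∣A∣ : ∣ S⁰ ∣ ≡ ℕ.suc ∣ A ∣
    ∣S⁰∣≡1+∣A∣ = trans (same-size uniform (proj₁ critical) S₁∈F) (sym (x∈p⇒suc∣p-x∣≡∣p∣ i∈S₁))

    A⊆S⁰ : x ∈ S⁰ → x ∉ A → A ⊆ S⁰
    A⊆S⁰ x∈S⁰ x∉A = imageSub-⊆⁻ π (≤lex-downClosed (proj₂ critical S₁ S₁∈F) πA-downClosed
                                     (imageSub-⊆⁺ π (p─q⊆p S₁ ⁅ i ⁆))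
                                     (∈⇒π∈imageSub π x∈S⁰) (x∉A ∘ π∈imageSub⇒∈ π))
      where
      πA-downClosed : DownClosed (imageSub π A)
      πA-downClosed p≤q q∈πA = π⁻¹∈⇒∈imageSub π (key-lower (sorted p≤q) (∈imageSub⇒π⁻¹∈ π q∈πA))

    A∪⁅x⁆≡S⁰ : x ∈ S⁰ → x ∉ A → A ∪ ⁅ x ⁆ ≡ S⁰
    A∪⁅x⁆≡S⁰ {x} x∈S⁰ x∉A =
      p⊆q∧∣q∣≤∣p∣⇒p≡q A∪⁅x⁆⊆S⁰ (ℕₚ.≤-reflexive (trans ∣S⁰∣≡1+∣A∣ (sym (x∉p⇒∣p∪⁅x⁆∣≡suc∣p∣ x∉A))))
      where
      A∪⁅x⁆⊆S⁰ : A ∪ ⁅ x ⁆ ⊆ S⁰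
      A∪⁅x⁆⊆S⁰ z∈ with x∈p∪q⁻ A ⁅ x ⁆ z∈
      ... | inj₁ z∈A   = A⊆S⁰ x∈S⁰ x∉A z∈A
      ... | inj₂ z∈⁅x⁆ = subst (_∈ S⁰) (sym (x∈⁅y⁆⇒x≡y x z∈⁅x⁆)) x∈S⁰

    expensive : ∃[ x ] (x ∈ S⁰ × x ∉ A × x ∉ S₂)
    expensive with ⊈-witness (λ S⁰⊆A → ℕₚ.1+n≰n (subst (ℕ._≤ ∣ A ∣) ∣S⁰∣≡1+∣A∣ (p⊆q⇒∣p∣≤∣q∣ S⁰⊆A)))
    ... | x , x∈S⁰ , x∉A = x , x∈S⁰ , x∉A , x∉S₂
      where
      x∉S₁ : x ∈ S₂ → x ∉ S₁
      x∉S₁ x∈S₂ x∈S₁ with x Finₚ.≟ i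
      ... | yes refl = i∉S₂ x∈S₂
      ... | no x≢i   = x∉A (x∈p∧x≢y⇒x∈p-y x∈S₁ x≢i)
      x∉S₂ : x ∉ S₂
      x∉S₂ x∈S₂ = stuck x x∈S₂ (x∉S₁ x∈S₂) (subst (_∈F F) (sym (A∪⁅x⁆≡S⁰ x∈S⁰ x∉A)) (proj₁ critical))

    ¬optimal : ∀ (W : Matrix m) → (∀ i j → 0ℚ ≤ W i j) → (∀ {i j} → i ∈ S₂ → j ∈ S₂ → W i j ≡ 0ℚ) →
               (∀ {x} → x ∉ A → x ∉ S₂ → 0ℚ < W x x) → ¬ QMWBOptimal F W S⁰
    ¬optimal W W≥0 W-S₂ W-diagonal (_ , optimal) with expensive
    ... | x , x∈S⁰ , x∉A , x∉S₂ = <-irrefl refl (begin-strict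
      0ℚ      <⟨ W-diagonal x∉A x∉S₂ ⟩
      W x x   ≤⟨ ≤-Π W≥0 x∈S⁰ ⟩
      Π W S⁰  ≤⟨ optimal S₂ S₂∈F ⟩
      Π W S₂  ≡⟨ Π-vanishing W-S₂ ⟩
      0ℚ      ∎)
      where open ≤-Reasoning

    ¬cond2 : ¬ Cond2 F
    ¬cond2 cond2 = ¬optimal W (λ _ → cost-nonneg ∘ key) (λ _ → c-S₂) 0<c
                     (cond2 W π (λ _ _ _ → c-graded) S⁰ critical balanced)
      where
      W : Matrix m
      W _ j = c j
      balanced : MinWeightBase F (λ i → sumSub S⁰ (W i)) S⁰
      balanced = proj₁ critical , λ T T∈F → ≤-reflexive (begin
        sumSub S⁰ (λ _ → sumSub S⁰ c) ≡⟨ sumSub-const S⁰ _ ⟩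
        ∣ S⁰ ∣ · sumSub S⁰ c          ≡⟨ cong (_· sumSub S⁰ c) (same-size uniform (proj₁ critical) T∈F) ⟩
        ∣ T ∣ · sumSub S⁰ c           ≡⟨ sumSub-const T _ ⟨
        sumSub T (λ _ → sumSub S⁰ c)  ∎)
        where open ≡-Reasoning

    ¬cond3 : ¬ Cond3 F
    ¬cond3 cond3 = ¬optimal W W≥0 W-S₂ 0<Wxx (proj₁ (cond3 W π doubly-graded S⁰ critical))
      where
      W : Matrix m
      W i j = c i + c j
      doubly-graded : DoublyGraded (permMat π W)
      doubly-graded = (λ i _ _ j≤k → +-monoʳ-≤ (c (π ⟨$⟩ˡ i)) (c-graded j≤k))
                    , (λ i _ _ j≤k → +-monoˡ-≤ (c (π ⟨$⟩ˡ i)) (c-graded j≤k))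
      W≥0 : ∀ i j → 0ℚ ≤ W i j
      W≥0 i j = +-mono-≤ (cost-nonneg (key i)) (cost-nonneg (key j))
      W-S₂ : ∀ {i j} → i ∈ S₂ → j ∈ S₂ → W i j ≡ 0ℚ
      W-S₂ i∈S₂ j∈S₂ = cong₂ _+_ (c-S₂ i∈S₂) (c-S₂ j∈S₂)
      0<Wxx : ∀ {x} → x ∉ A → x ∉ S₂ → 0ℚ < W x x
      0<Wxx {x} x∉A x∉S₂ = +-mono-<-≤ (0<c x∉A x∉S₂) (cost-nonneg (key x))

  open Refutation {π = proj₁ (sorting key)} (proj₂ (sorting key))
                  {S⁰ = proj₁ (critical-exists F≢[] (proj₁ (sorting key)))}
                  (proj₂ (critical-exists F≢[] (proj₁ (sorting key))))
    public using (¬cond2; ¬cond3)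

theorem11 : (m s : ℕ) (F : Family m) → F ≢ [] → All (λ S → ∣ S ∣ ≡ s) F →
    (Exchange F ⇔ Cond2 F) × (Exchange F ⇔ Cond3 F)
theorem11 m s F F≢[] uniform =
  mk⇔ (Matroid.exchange⇒cond2 uniform)
      (λ cond2 → ¬violation⇒exchange λ v → Counterexample.¬cond2 uniform F≢[] v cond2) ,
  mk⇔ (Matroid.exchange⇒cond3 uniform)
      (λ cond3 → ¬violation⇒exchange λ v → Counterexample.¬cond3 uniform F≢[] v cond3)
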